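{- Let $n\geq 4$ and $i\in[1,n]$, and let $e=\{x,x+\delta_i\}$ be an edge of $\Gamma_n$. Then $imb(e)=|d(x)-d(x+\delta_i)|$ is determined as follows: (1) if $i=1$: $imb(e)=0$ if $x_3=1$ and $imb(e)=1$ if $x_3=0$; (2) if $i=2$: $imb(e)=1$ if $x_4=1$ and $imb(e)=2$ if $x_4=0$; (3) if $3\leq i\leq n-2$: $imb(e)=0$ if $x_{i-2}=x_{i+2}=1$, $imb(e)=2$ if $x_{i-2}=x_{i+2}=0$, and $imb(e)=1$ if exactly one of $x_{i-2},x_{i+2}$ equals $1$; (4) if $i=n-1$: $imb(e)=1$ if $x_{n-3}=1$ and $imb(e)=2$ if $x_{n-3}=0$; (5) if $i=n$: $imb(e)=0$ if $x_{n-2}=1$ and $imb(e)=1$ if $x_{n-2}=0$.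
   Context: The hypercube $Q_n$ has vertex set the binary strings of length $n$, adjacency meaning differing in exactly one position. For $x=x_1\ldots x_n$, $x+\delta_i$ is $x$ with its $i$-th coordinate complemented. A Fibonacci string is a binary string with no two consecutive 1's; $\Gamma_n$ is the subgraph of $Q_n$ induced by Fibonacci strings of length $n$. Degrees $d$ are taken in $\Gamma_n$, and $imb(\{u,v\})=|d(u)-d(v)|$. -}

module Defs where

open import Data.Bool using (Bool; true; false; not; _∧_; T)
open import Data.Nat using (ℕ; zero; suc; _+_; ∣_-_∣)
open import Data.Vec using (Vec; []; _∷_)
open import Data.List using (List; length; filter; map; upTo)
open import Relation.Nullary.Decidable using (Dec)
open import Data.Bool.Properties using (T?)

-- Binary strings of length n: x = x₁ … xₙ as a vector of booleans (true = 1).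

-- bit x k = x_k, positions are 1-indexed (k ∈ [1,n]); out of range gives false
bit : {n : ℕ} → Vec Bool n → ℕ → Bool
bit []       _             = false
bit (b ∷ xs) zero          = false
bit (b ∷ xs) (suc zero)    = b
bit (b ∷ xs) (suc (suc k)) = bit xs (suc k)

flip : {n : ℕ} → Vec Bool n → ℕ → Vec Bool n
flip []       _             = []
flip (b ∷ xs) zero          = b ∷ xs
flip (b ∷ xs) (suc zero)    = not b ∷ xs
flip (b ∷ xs) (suc (suc k)) = b ∷ flip xs (suc k)

isFib : {n : ℕ} → Vec Bool n → Bool
isFib []           = true
isFib (b ∷ [])     = true
isFib (a ∷ b ∷ xs) = not (a ∧ b) ∧ isFib (b ∷ xs)

Fibonacci : {n : ℕ} → Vec Bool n → Set
Fibonacci x = T (isFib x)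

deg : {n : ℕ} → Vec Bool n → ℕ
deg {n} x = length (filter (λ k → T? (isFib (flip x k))) (map suc (upTo n)))

imb : {n : ℕ} → Vec Bool n → Vec Bool n → ℕ
imb u v = ∣ deg u - deg v ∣

-- A position k of a Fibonacci string x can be flipped iff x_k = 1 or both neighbours of x_k are 0,
-- so deg x is a sum of indicators of three-bit windows.  If x and x + δ_i are both Fibonacci, then
-- x_{i-1} = x_{i+1} = 0 and only the windows at i - 1, i, i + 1 differ: the one at i is flippable
-- in both strings, and the one at i ± 1 (if it exists) is flippable only in the string with a 0 at
-- position i, and there iff x_{i±2} = 0.  Prefixing x with 1 0 changes no window count and turns
-- position 1 into an interior position.
module Submission where

open import Defs
open import Data.Bool using (Bool; true; false; not; _∧_; _∨_)
open import Data.Bool.Properties using (T?; T-≡; T-∧; ∧-identityʳ)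
open import Data.Nat using (ℕ; zero; suc; _+_; _∸_; _≤_; ∣_-_∣; z≤n; s≤s)
open import Data.Nat.Properties using (+-comm; +-assoc; ∣m+n-m+o∣≡∣n-o∣; m≤n⇒m≤1+n)
open import Data.List using (length; filter; map; upTo; applyUpTo)
open import Data.List.Properties using (map-upTo)
open import Data.Vec using (Vec; []; _∷_)
open import Data.Product using (_×_; _,_; proj₁; proj₂)
open import Function using (_∘_)
open import Function.Bundles using (Equivalence)
open import Relation.Binary.PropositionalEquality using (_≡_; refl; sym; trans; cong; cong₂; module ≡-Reasoning)

open ≡-Reasoning

private
  variable
    m : ℕ

toℕ : Bool → ℕ
toℕ false = 0
toℕ true  = 1

count< : (ℕ → Bool) → ℕ → ℕ
count< p zero    = 0
count< p (suc m) = toℕ (p 0) + count< (p ∘ suc) m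

length-filter-applyUpTo : ∀ (p : ℕ → Bool) f m →
  length (filter (λ k → T? (p k)) (applyUpTo f m)) ≡ count< (p ∘ f) m
length-filter-applyUpTo p f zero = refl
length-filter-applyUpTo p f (suc m) with p (f 0)
... | true  = cong suc (length-filter-applyUpTo p (f ∘ suc) m)
... | false = length-filter-applyUpTo p (f ∘ suc) m

count<-cong : ∀ {p q} → (∀ k → p k ≡ q k) → ∀ m → count< p m ≡ count< q m
count<-cong p≗q zero    = refl
count<-cong p≗q (suc m) = cong₂ _+_ (cong toℕ (p≗q 0)) (count<-cong (p≗q ∘ suc) m)

Fibonacci-tail : ∀ a (xs : Vec Bool m) → Fibonacci (a ∷ xs) → Fibonacci xs
Fibonacci-tail a []       _   = _
Fibonacci-tail a (b ∷ xs) fib = proj₂ (Equivalence.to (T-∧ {not (a ∧ b)}) fib)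

Fibonacci-false-∷ : (xs : Vec Bool m) → Fibonacci xs → Fibonacci (false ∷ xs)
Fibonacci-false-∷ []      _   = _
Fibonacci-false-∷ (_ ∷ _) fib = fib

left-neighbour-false : ∀ a b (xs : Vec Bool m) →
  Fibonacci (a ∷ b ∷ xs) → Fibonacci (a ∷ not b ∷ xs) → a ≡ false
left-neighbour-false true  true  _ () _
left-neighbour-false true  false _ _ ()
left-neighbour-false false _     _ _ _ = refl

right-neighbour-false : ∀ a b (xs : Vec Bool m) →
  Fibonacci (a ∷ b ∷ xs) → Fibonacci (not a ∷ b ∷ xs) → b ≡ false
right-neighbour-false true  true  _ () _
right-neighbour-false false true  _ _ ()
right-neighbour-false _     false _ _ _ = refl

flippable : Bool → Bool → Bool → Bool
flippable l c r = c ∨ not (l ∨ r)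

isFib-flip-head : ∀ l c (xs : Vec Bool m) → Fibonacci (l ∷ c ∷ xs) →
  isFib (l ∷ not c ∷ xs) ≡ flippable l c (bit xs 1)
isFib-flip-head true  true  xs       ()
isFib-flip-head true  false []       _   = refl
isFib-flip-head true  false (_ ∷ _)  _   = refl
isFib-flip-head false true  []       _   = refl
isFib-flip-head false false []       _   = refl
isFib-flip-head false true  (b ∷ xs) fib =
  Equivalence.to T-≡ (Fibonacci-tail true (b ∷ xs) fib)
isFib-flip-head false false (b ∷ xs) fib = begin
  not b ∧ isFib (b ∷ xs) ≡⟨ cong (not b ∧_) (Equivalence.to T-≡ (Fibonacci-tail false (b ∷ xs) fib)) ⟩
  not b ∧ true           ≡⟨ ∧-identityʳ (not b) ⟩
  not b                  ∎

-- l is the bit just before xs.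
degFrom : Bool → Vec Bool m → ℕ
degFrom l []       = 0
degFrom l (c ∷ xs) = toℕ (flippable l c (bit xs 1)) + degFrom c xs

count<-flippable : ∀ l (xs : Vec Bool m) → Fibonacci (l ∷ xs) →
  count< (λ k → isFib (l ∷ flip xs (suc k))) m ≡ degFrom l xs
count<-flippable l []       _   = refl
count<-flippable {suc m} l (c ∷ xs) fib = cong₂ _+_
  (cong toℕ (isFib-flip-head l c xs fib))
  (trans (count<-cong (λ k → cong (_∧ isFib (c ∷ flip xs (suc k))) lc) m)
         (count<-flippable c xs (Fibonacci-tail l (c ∷ xs) fib)))
  where
  lc : not (l ∧ c) ≡ true
  lc = Equivalence.to T-≡ (proj₁ (Equivalence.to (T-∧ {not (l ∧ c)}) fib))

isFib-false-∷ : (xs : Vec Bool m) → isFib (false ∷ xs) ≡ isFib xs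
isFib-false-∷ []      = refl
isFib-false-∷ (_ ∷ _) = refl

deg≡degFrom : (x : Vec Bool m) → Fibonacci x → deg x ≡ degFrom false x
deg≡degFrom {m} x fib = begin
  length (filter (λ k → T? (isFib (flip x k))) (map suc (upTo m)))
    ≡⟨ cong (λ ks → length (filter (λ k → T? (isFib (flip x k))) ks)) (map-upTo suc m) ⟩
  length (filter (λ k → T? (isFib (flip x k))) (applyUpTo suc m))
    ≡⟨ length-filter-applyUpTo (λ k → isFib (flip x k)) suc m ⟩
  count< (λ k → isFib (flip x (suc k))) m
    ≡⟨ count<-cong (λ k → sym (isFib-false-∷ (flip x (suc k)))) m ⟩
  count< (λ k → isFib (false ∷ flip x (suc k))) m
    ≡⟨ count<-flippable false x (Fibonacci-false-∷ x fib) ⟩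
  degFrom false x ∎

-- 1 iff position i + 1 of xs exists and position i + 2 holds a 0 or lies beyond the end of xs.
rightGap : Vec Bool m → ℕ → ℕ
rightGap []       _       = 0
rightGap (_ ∷ xs) zero    = toℕ (not (bit xs 1))
rightGap (_ ∷ xs) (suc i) = rightGap xs i

rightGap-inner : ∀ (xs : Vec Bool m) i → suc i ≤ m → rightGap xs i ≡ toℕ (not (bit xs (2 + i)))
rightGap-inner (_ ∷ xs) zero    _         = refl
rightGap-inner (_ ∷ xs) (suc i) (s≤s i<m) = rightGap-inner xs i i<m

rightGap-penultimate : (xs : Vec Bool (suc m)) → rightGap xs m ≡ 1
rightGap-penultimate (_ ∷ [])     = refl
rightGap-penultimate (_ ∷ y ∷ ys) = rightGap-penultimate (y ∷ ys)

rightGap-last : (xs : Vec Bool m) → rightGap xs m ≡ 0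
rightGap-last []       = refl
rightGap-last (_ ∷ xs) = rightGap-last xs

windowSum : Bool → Bool → Bool → Bool → Bool → ℕ
windowSum l a b c r = toℕ (flippable l a b) + (toℕ (flippable a b c) + toℕ (flippable b c r))

degFrom-∷∷∷ : ∀ l a b c (xs : Vec Bool m) →
  degFrom l (a ∷ b ∷ c ∷ xs) ≡ degFrom c xs + windowSum l a b c (bit xs 1)
degFrom-∷∷∷ l a b c xs = begin
  u + (v + (w + d)) ≡⟨ cong (u +_) (sym (+-assoc v w d)) ⟩
  u + ((v + w) + d) ≡⟨ sym (+-assoc u (v + w) d) ⟩
  (u + (v + w)) + d ≡⟨ +-comm (u + (v + w)) d ⟩
  d + (u + (v + w)) ∎
  where
  u = toℕ (flippable l a b)
  v = toℕ (flippable a b c)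
  w = toℕ (flippable b c (bit xs 1))
  d = degFrom c xs

windowSum-flip-centre : ∀ l b r →
  ∣ windowSum l false b false r - windowSum l false (not b) false r ∣ ≡ toℕ (not l) + toℕ (not r)
windowSum-flip-centre true  true  true  = refl
windowSum-flip-centre true  true  false = refl
windowSum-flip-centre true  false true  = refl
windowSum-flip-centre true  false false = refl
windowSum-flip-centre false true  true  = refl
windowSum-flip-centre false true  false = refl
windowSum-flip-centre false false true  = refl
windowSum-flip-centre false false false = refl

degFrom-flip-last : ∀ l b →
  ∣ degFrom l (false ∷ b ∷ []) - degFrom l (false ∷ not b ∷ []) ∣ ≡ toℕ (not l) + 0
degFrom-flip-last true  true  = refl
degFrom-flip-last true  false = refl
degFrom-flip-last false true  = refl
degFrom-flip-last false false = refl

degFrom-flip-second : ∀ l b (xs : Vec Bool m) →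
  ∣ degFrom l (false ∷ b ∷ false ∷ xs) - degFrom l (false ∷ not b ∷ false ∷ xs) ∣
    ≡ toℕ (not l) + toℕ (not (bit xs 1))
degFrom-flip-second l b xs = begin
  ∣ degFrom l (false ∷ b ∷ false ∷ xs) - degFrom l (false ∷ not b ∷ false ∷ xs) ∣
    ≡⟨ cong₂ ∣_-_∣ (degFrom-∷∷∷ l false b false xs) (degFrom-∷∷∷ l false (not b) false xs) ⟩
  ∣ degFrom false xs + windowSum l false b false r - degFrom false xs + windowSum l false (not b) false r ∣
    ≡⟨ ∣m+n-m+o∣≡∣n-o∣ (degFrom false xs) _ _ ⟩
  ∣ windowSum l false b false r - windowSum l false (not b) false r ∣
    ≡⟨ windowSum-flip-centre l b r ⟩
  toℕ (not l) + toℕ (not r) ∎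
  where r = bit xs 1

bit₁-flip : ∀ (xs : Vec Bool m) j → bit (flip xs (2 + j)) 1 ≡ bit xs 1
bit₁-flip []      _ = refl
bit₁-flip (_ ∷ _) _ = refl

degFrom-flip : ∀ l (xs : Vec Bool m) j → 2 + j ≤ m →
  Fibonacci (l ∷ xs) → Fibonacci (l ∷ flip xs (2 + j)) →
  ∣ degFrom l xs - degFrom l (flip xs (2 + j)) ∣ ≡ toℕ (not (bit (l ∷ xs) (suc j))) + rightGap xs (2 + j)
degFrom-flip l []       j       ()
degFrom-flip l (a ∷ []) zero    (s≤s ())
degFrom-flip l (a ∷ b ∷ []) zero _ fib fib′
  with refl ← left-neighbour-false a b [] (Fibonacci-tail l (a ∷ b ∷ []) fib)
                                          (Fibonacci-tail l (a ∷ not b ∷ []) fib′)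
  = degFrom-flip-last l b
degFrom-flip l (a ∷ b ∷ c ∷ xs) zero _ fib fib′
  with refl ← left-neighbour-false a b (c ∷ xs) (Fibonacci-tail l (a ∷ b ∷ c ∷ xs) fib)
                                                (Fibonacci-tail l (a ∷ not b ∷ c ∷ xs) fib′)
     | refl ← right-neighbour-false b c xs
                (Fibonacci-tail a (b ∷ c ∷ xs) (Fibonacci-tail l (a ∷ b ∷ c ∷ xs) fib))
                (Fibonacci-tail a (not b ∷ c ∷ xs) (Fibonacci-tail l (a ∷ not b ∷ c ∷ xs) fib′))
  = degFrom-flip-second l b xs
degFrom-flip l (a ∷ xs) (suc j) (s≤s j<m) fib fib′ rewrite bit₁-flip xs j =
  trans (∣m+n-m+o∣≡∣n-o∣ (toℕ (flippable l a (bit xs 1))) _ _)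
        (degFrom-flip a xs j j<m (Fibonacci-tail l (a ∷ xs) fib)
                                 (Fibonacci-tail l (a ∷ flip xs (2 + j)) fib′))

-- bit (true ∷ false ∷ x) (suc i) is x_{i-2}, read as 1 for i = 1 and as 0 for i = 2.
imb-flip : ∀ (x : Vec Bool m) i → suc i ≤ m → Fibonacci x → Fibonacci (flip x (suc i)) →
  imb x (flip x (suc i)) ≡ toℕ (not (bit (true ∷ false ∷ x) (suc i))) + rightGap x (suc i)
imb-flip x i i<m fib fib′ = begin
  imb x (flip x (suc i))
    ≡⟨ cong₂ ∣_-_∣ (deg≡degFrom x fib) (deg≡degFrom (flip x (suc i)) fib′) ⟩
  -- degFrom false x and degFrom true (false ∷ x) agree by definition.
  ∣ degFrom true (false ∷ x) - degFrom true (false ∷ flip x (suc i)) ∣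
    ≡⟨ degFrom-flip true (false ∷ x) i (s≤s i<m)
         (Fibonacci-false-∷ x fib) (Fibonacci-false-∷ (flip x (suc i)) fib′) ⟩
  toℕ (not (bit (true ∷ false ∷ x) (suc i))) + rightGap x (suc i) ∎

split-bit : ∀ {m} (f : Bool → ℕ) {b} → m ≡ f b →
  (b ≡ true → m ≡ f true) × (b ≡ false → m ≡ f false)
split-bit f m≡fb = (λ b≡t → trans m≡fb (cong f b≡t)) , (λ b≡f → trans m≡fb (cong f b≡f))

split-bits : ∀ {m} (f : Bool → Bool → ℕ) {a b} → m ≡ f a b →
    (a ≡ true  → b ≡ true  → m ≡ f true  true)
  × (a ≡ false → b ≡ false → m ≡ f false false)
  × (a ≡ true  → b ≡ false → m ≡ f true  false)
  × (a ≡ false → b ≡ true  → m ≡ f false true)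
split-bits {m} f {a} {b} m≡fab = by , by , by , by
  where
  by : ∀ {c d} → a ≡ c → b ≡ d → m ≡ f c d
  by a≡c b≡d = trans m≡fab (cong₂ f a≡c b≡d)

mainTheorem3 : (n : ℕ) → 4 ≤ n → (i : ℕ) → 1 ≤ i → i ≤ n →
    (x : Vec Bool n) → Fibonacci x → Fibonacci (flip x i) →
    (i ≡ 1 →
        (bit x 3 ≡ true → imb x (flip x i) ≡ 0)
      × (bit x 3 ≡ false → imb x (flip x i) ≡ 1))
    × (i ≡ 2 →
        (bit x 4 ≡ true → imb x (flip x i) ≡ 1)
      × (bit x 4 ≡ false → imb x (flip x i) ≡ 2))
    × (3 ≤ i → i ≤ n ∸ 2 →
        (bit x (i ∸ 2) ≡ true → bit x (i + 2) ≡ true → imb x (flip x i) ≡ 0)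
      × (bit x (i ∸ 2) ≡ false → bit x (i + 2) ≡ false → imb x (flip x i) ≡ 2)
      × (bit x (i ∸ 2) ≡ true → bit x (i + 2) ≡ false → imb x (flip x i) ≡ 1)
      × (bit x (i ∸ 2) ≡ false → bit x (i + 2) ≡ true → imb x (flip x i) ≡ 1))
    × (i ≡ n ∸ 1 →
        (bit x (n ∸ 3) ≡ true → imb x (flip x i) ≡ 1)
      × (bit x (n ∸ 3) ≡ false → imb x (flip x i) ≡ 2))
    × (i ≡ n →
        (bit x (n ∸ 2) ≡ true → imb x (flip x i) ≡ 0)
      × (bit x (n ∸ 2) ≡ false → imb x (flip x i) ≡ 1))
mainTheorem3 (suc (suc (suc (suc k)))) (s≤s (s≤s (s≤s (s≤s z≤n)))) (suc i) _ i≤n x fib fib′ =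
    (λ { refl → split-bit gap (trans imbalance (rightGap-inner x 1 (s≤s (s≤s z≤n)))) })
  , (λ { refl → split-bit (λ b → 1 + gap b)
                  (trans imbalance (cong (1 +_) (rightGap-inner x 2 (s≤s (s≤s (s≤s z≤n)))))) })
  , (λ { (s≤s (s≤s (s≤s z≤n))) i≤n∸2 → split-bits (λ a b → gap a + gap b)
                  (trans imbalance (cong (outerLeft +_) (rightGap-middle i≤n∸2))) })
  , (λ { refl → split-bit (λ b → gap b + 1) (trans imbalance (cong (outerLeft +_) (rightGap-penultimate x))) })
  , (λ { refl → split-bit (λ b → gap b + 0) (trans imbalance (cong (outerLeft +_) (rightGap-last x))) })
  where
  gap : Bool → ℕ
  gap b = toℕ (not b)

  outerLeft : ℕ
  outerLeft = gap (bit (true ∷ false ∷ x) (suc i))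

  imbalance : imb x (flip x (suc i)) ≡ outerLeft + rightGap x (suc i)
  imbalance = imb-flip x i i≤n fib fib′

  rightGap-middle : suc i ≤ suc (suc k) → rightGap x (suc i) ≡ gap (bit x (suc i + 2))
  rightGap-middle i≤n∸2 = trans (rightGap-inner x (suc i) (s≤s (m≤n⇒m≤1+n i≤n∸2)))
                                (cong (gap ∘ bit x) (+-comm 2 (suc i)))
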